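{- Let $F$ be a forest that admits a $(k,c)$-embedding into the line. Then there exists some $X\subseteq V(F)$ with $|X|\le k$ such that $F\setminus X$ does not contain any $(c/2+1)$-tripod as a subgraph.
   Context: Graphs are finite, undirected, unweighted; $d_\Gamma$ is the shortest-path metric. The distortion of an injection $f:(X,\rho)\to(X',\rho')$ is $\sup_{x\neq y}\frac{\rho'(f(x),f(y))}{\rho(x,y)}\cdot\sup_{x\neq y}\frac{\rho(x,y)}{\rho'(f(x),f(y))}$. $\Gamma$ admits a $(k,c)$-embedding into the line if there exist $K\subseteq V(\Gamma)$, $|K|\le k$, and an injective $f:V(\Gamma)\setminus K\to\mathbb{R}$ of distortion at most $c$ w.r.t. $d_\Gamma$ restricted to $V(\Gamma)\setminus K$. An $R$-tripod in a graph $G$ with root $v$: vertices $v,v_1,v_2,v_3$ and paths $P_1,P_2,P_3$ in $G$, $P_i$ from $v$ to $v_i$, such that for all $i\neq j$ and all $u\in P_j$, $d_G(v_i,u)\geq R$; the tripod is the tree $P_1\cup P_2\cup P_3$.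
   Formalization: The distortion bound c is only rational, and the embedding f takes values in ℚ rather than in ℝ. -}

module Defs where

open import Data.Nat using (ℕ; zero; suc; _≤_)
open import Data.Bool using (Bool; true; false)
open import Data.Fin using (Fin)
open import Data.Fin.Subset using (Subset; _∈_; _∉_; ∣_∣)
open import Data.List using (List; []; _∷_; length)
open import Data.List.Relation.Unary.Unique.Propositional using (Unique)
open import Data.Product using (Σ; ∃; ∃-syntax; _×_; _,_)
open import Data.Empty using (⊥)
open import Relation.Nullary using (¬_)
open import Relation.Binary.PropositionalEquality using (_≡_; _≢_)
open import Data.Integer using (+_)
open import Data.Rational using (ℚ; _/_; _+_; _-_; _*_; 0ℚ; 1ℚ) renaming (_≤_ to _≤ℚ_; ∣_∣ to abs)

record Graph (n : ℕ) : Set where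
  field
    adj   : Fin n → Fin n → Bool
    sym   : ∀ x y → adj x y ≡ adj y x
    irrefl : ∀ x → adj x x ≡ false
open Graph public

ℕ→ℚ : ℕ → ℚ
ℕ→ℚ m = (+ m) / 1

module _ {n : ℕ} (G : Graph n) where

  -- Walk S x y m : a walk of length m from x to y in G all of whose vertices
  -- lie in the vertex set S (S = the vertex set of the induced subgraph).
  data Walk (S : Fin n → Set) : Fin n → Fin n → ℕ → Set where
    stay : ∀ {x} → S x → Walk S x x 0
    step : ∀ {x y z m} → S x → adj G x y ≡ true → Walk S y z m → Walk S x z (suc m)

  -- Dist S x y m : the shortest-path distance from x to y in the subgraph of G
  -- induced by S equals m (no such m exists when x,y are disconnected, i.e. d = ∞).
  Dist : (Fin n → Set) → Fin n → Fin n → ℕ → Set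
  Dist S x y m = Walk S x y m × (∀ m' → Walk S x y m' → m ≤ m')

  data PathList (S : Fin n → Set) : Fin n → Fin n → List (Fin n) → Set where
    single : ∀ {x} → S x → PathList S x x (x ∷ [])
    cons   : ∀ {x y z p} → S x → adj G x y ≡ true → PathList S y z p →
             PathList S x z (x ∷ p)

  IsPath : (Fin n → Set) → Fin n → Fin n → List (Fin n) → Set
  IsPath S x y p = PathList S x y p × Unique p

  All : Fin n → Set
  All _ = Data.Unit.⊤
    where import Data.Unit

  HasCycle : Set
  HasCycle = ∃[ x ] ∃[ y ] ∃[ p ] (IsPath All x y p × 3 ≤ length p × adj G y x ≡ true)

  IsForest : Set
  IsForest = ¬ HasCycle

  -- (k,c)-embedding into the line (with values in ℚ):
  -- K ⊆ V with |K| ≤ k and an injective f : V∖K → ℚ whose distortion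
  -- (sup ρ'/ρ) · (sup ρ/ρ') w.r.t. d_G restricted to V∖K is at most c;
  -- "sup ≤ A" is written out as "every ratio ≤ A".
  Outside : Subset n → Fin n → Set
  Outside K x = x ∉ K

  DistortionAtMost : (K : Subset n) → (f : Fin n → ℚ) → ℚ → Set
  DistortionAtMost K f c =
    ∃[ A ] ∃[ B ] (0ℚ ≤ℚ A × 0ℚ ≤ℚ B × (A * B) ≤ℚ c ×
      (∀ x y → x ∉ K → y ∉ K → x ≢ y →
         ∃[ m ] (Dist All x y m ×
                 abs (f x - f y) ≤ℚ (A * ℕ→ℚ m) ×
                 ℕ→ℚ m ≤ℚ (B * abs (f x - f y)))))

  Embeds : ℕ → ℚ → Set
  Embeds k c = ∃[ K ] (∣ K ∣ ≤ k × ∃[ f ]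
    ((∀ x y → x ∉ K → y ∉ K → f x ≡ f y → x ≡ y) × DistortionAtMost K f c))

  Tripod : Subset n → ℚ → Set
  Tripod X R =
    ∃[ v ] ∃[ v₁ ] ∃[ v₂ ] ∃[ v₃ ] ∃[ P₁ ] ∃[ P₂ ] ∃[ P₃ ]
      (IsPath (Outside X) v v₁ P₁ × IsPath (Outside X) v v₂ P₂ × IsPath (Outside X) v v₃ P₃ ×
       Far v₁ P₂ × Far v₁ P₃ × Far v₂ P₁ × Far v₂ P₃ × Far v₃ P₁ × Far v₃ P₂)
    where
    open import Data.List.Membership.Propositional renaming (_∈_ to _∈L_)
    -- d_{G∖X}(w,u) ≥ R for all u on P (vacuous if the distance is ∞)
    Far : Fin n → List (Fin n) → Set
    Far w P = ∀ u → u ∈L P → ∀ m → Dist (Outside X) w u m → R ≤ℚ ℕ→ℚ m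

{-# OPTIONS --safe #-}
module Submission where

-- Keep the vertex set K of the embedding f, which is A-Lipschitz on edges and
-- satisfies d ≤ B |f x - f y| with A B ≤ c. In a tripod of F ∖ K the value of f
-- at one leaf v lies between its values at the other two leaves, hence between
-- f(root) and f at one of them, say w. Along the arm from the root to w, f moves
-- by at most A per edge, so some vertex u of that arm has |f v - f u| ≤ A/2,
-- i.e. d_F(v,u) ≤ A B / 2 ≤ c/2. In a forest the path from v to u is the one
-- through the root, which avoids K, so d_{F∖K}(v,u) ≤ c/2 < c/2 + 1: the arm is
-- not far from v.

open import Defs
open import Data.Nat using (ℕ; _≤_)
open import Data.Fin.Subset using (Subset; ∣_∣)
open import Data.Product using (∃-syntax; _×_)
open import Relation.Nullary using (¬_)
open import Data.Rational using (ℚ; _+_; _*_; ½; 1ℚ)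

open import Data.Nat using (suc; z≤n; s≤s)
import Data.Nat as ℕ
import Data.Nat.Properties as ℕₚ
open import Data.Rational using (_-_; -_; 0ℚ; _<_; NonNegative; nonNegative)
  renaming (_≤_ to _≤ℚ_; ∣_∣ to abs)
open import Data.Rational.Properties
  using ( ≤-refl; ≤-trans; ≤-total; <-irrefl; <-≤-trans; _≤?_; ≰⇒>
        ; ≤ᵇ⇒≤; positive⁻¹; +-inverseʳ; +-identityʳ; +-monoˡ-≤
        ; +-monoʳ-<; +-mono-<; *-identityʳ; *-zeroʳ; *-monoˡ-≤-nonNeg
        ; *-monoʳ-≤-nonNeg; 0≤∣p∣; 0≤p⇒∣p∣≡p; ∣-p∣≡∣p∣; module ≤-Reasoning)
open import Data.Rational.Solver using (module +-*-Solver)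
open import Data.Fin using (Fin)
open import Data.Fin.Properties using (_≟_)
open import Data.Bool using (true)
open import Data.Unit using (tt)
open import Data.Empty using (⊥; ⊥-elim)
open import Data.Product using (Σ-syntax; _,_)
open import Data.Sum using (_⊎_; inj₁; inj₂; swap; reduce)
open import Data.List using (List; []; _∷_; length)
open import Data.List.Membership.Propositional using (_∈_)
open import Data.List.Relation.Unary.Any using (here; there)
import Data.List.Relation.Unary.All as List
open import Data.List.Relation.Unary.All using ([]; _∷_)
open import Data.List.Relation.Unary.All.Properties using (¬Any⇒All¬)
open import Data.List.Relation.Unary.AllPairs using ([]; _∷_)
open import Data.List.Relation.Unary.Unique.Propositional using (Unique)
open import Data.List.Relation.Binary.Sublist.Propositional
  using (_⊆_; _⊇_; []; _∷_; _∷ʳ_; minimum; ⊆-refl)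
open import Data.List.Relation.Binary.Sublist.Propositional.Properties using (All-resp-⊆)
open import Relation.Binary.Core using (Rel)
open import Relation.Binary.Definitions using (Total; _Respects_)
open import Relation.Nullary using (yes; no)
open import Relation.Binary.PropositionalEquality as ≡ using (_≡_; _≢_; refl; cong; subst; subst₂)

module Betweenness {a ℓ} {A : Set a} {_≤_ : Rel A ℓ} (total : Total _≤_) where

  Between : A → A → A → Set ℓ
  Between b p q = (p ≤ b × b ≤ q) ⊎ (q ≤ b × b ≤ p)

  between-split : ∀ {b p q} → Between b p q → ∀ a → Between b a p ⊎ Between b a q
  between-split {b} (inj₁ (p≤b , b≤q)) a with total a b
  ... | inj₁ a≤b = inj₂ (inj₁ (a≤b , b≤q))
  ... | inj₂ b≤a = inj₁ (inj₂ (p≤b , b≤a))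
  between-split {b} (inj₂ (q≤b , b≤p)) a with total a b
  ... | inj₁ a≤b = inj₁ (inj₁ (a≤b , b≤p))
  ... | inj₂ b≤a = inj₂ (inj₂ (q≤b , b≤a))

  median : ∀ a b c → Between a b c ⊎ Between b a c ⊎ Between c a b
  median a b c with total a b | total b c | total a c
  ... | inj₁ a≤b | inj₁ b≤c | _        = inj₂ (inj₁ (inj₁ (a≤b , b≤c)))
  ... | inj₁ a≤b | inj₂ c≤b | inj₁ a≤c = inj₂ (inj₂ (inj₁ (a≤c , c≤b)))
  ... | inj₁ a≤b | inj₂ c≤b | inj₂ c≤a = inj₁ (inj₂ (c≤a , a≤b))
  ... | inj₂ b≤a | inj₁ b≤c | inj₁ a≤c = inj₁ (inj₁ (b≤a , a≤c))
  ... | inj₂ b≤a | inj₁ b≤c | inj₂ c≤a = inj₂ (inj₂ (inj₂ (b≤c , c≤a)))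
  ... | inj₂ b≤a | inj₂ c≤b | _        = inj₂ (inj₁ (inj₂ (c≤b , b≤a)))

open Betweenness ≤-total

Unique-resp-⊇ : ∀ {a} {A : Set a} → Unique {A = A} Respects _⊇_
Unique-resp-⊇ []       []          = []
Unique-resp-⊇ (_ ∷ʳ τ) (_ ∷ u)     = Unique-resp-⊇ τ u
Unique-resp-⊇ (refl ∷ τ) (x∉ ∷ u) = All-resp-⊆ τ x∉ ∷ Unique-resp-⊇ τ u

module RationalIdentities where
  open +-*-Solver

  neg-sub : ∀ p q → - (p - q) ≡ q - p
  neg-sub = solve 2 (λ p q → :- (p :- q) := q :- p) refl

  sub-add-sub : ∀ p b q → (b - p) + (q - b) ≡ q - p
  sub-add-sub = solve 3 (λ p b q → (b :- p) :+ (q :- b) := q :- p) refl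

  half+half : ∀ p → p * ½ + p * ½ ≡ p
  half+half = solve 1 (λ p → p :* con ½ :+ p :* con ½ := p) refl

  *-½-swap : ∀ p q → q * (p * ½) ≡ (p * q) * ½
  *-½-swap = solve 2 (λ p q → q :* (p :* con ½) := (p :* q) :* con ½) refl

open RationalIdentities

p+1≰p : ∀ p → ¬ (p + 1ℚ ≤ℚ p)
p+1≰p p p+1≤p = <-irrefl refl (<-≤-trans p<p+1 p+1≤p)
  where
  p<p+1 : p < p + 1ℚ
  p<p+1 = subst (_< p + 1ℚ) (+-identityʳ p) (+-monoʳ-< p (positive⁻¹ 1ℚ))

p≤q⇒0≤q-p : ∀ {p q} → p ≤ℚ q → 0ℚ ≤ℚ q - p
p≤q⇒0≤q-p {p} {q} p≤q = subst (_≤ℚ q - p) (+-inverseʳ p) (+-monoˡ-≤ (- p) p≤q)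

∣p-q∣≡∣q-p∣ : ∀ p q → abs (p - q) ≡ abs (q - p)
∣p-q∣≡∣q-p∣ p q = ≡.trans (≡.sym (∣-p∣≡∣p∣ (p - q))) (cong abs (neg-sub p q))

p≤q⇒∣q-p∣≡q-p : ∀ {p q} → p ≤ℚ q → abs (q - p) ≡ q - p
p≤q⇒∣q-p∣≡q-p p≤q = 0≤p⇒∣p∣≡p (p≤q⇒0≤q-p p≤q)

p≤q⇒∣p-q∣≡q-p : ∀ {p q} → p ≤ℚ q → abs (p - q) ≡ q - p
p≤q⇒∣p-q∣≡q-p {p} {q} p≤q = ≡.trans (∣p-q∣≡∣q-p∣ p q) (p≤q⇒∣q-p∣≡q-p p≤q)

close-to-an-end-ordered : ∀ {A b p q} → p ≤ℚ b → b ≤ℚ q → q - p ≤ℚ A →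
                   abs (b - p) ≤ℚ A * ½ ⊎ abs (b - q) ≤ℚ A * ½
close-to-an-end-ordered {A} {b} {p} {q} p≤b b≤q q-p≤A with b - p ≤? A * ½ | q - b ≤? A * ½
... | yes b-p≤h | _ = inj₁ (subst (_≤ℚ A * ½) (≡.sym (p≤q⇒∣q-p∣≡q-p p≤b)) b-p≤h)
... | no _ | yes q-b≤h = inj₂ (subst (_≤ℚ A * ½) (≡.sym (p≤q⇒∣p-q∣≡q-p b≤q)) q-b≤h)
... | no b-p≰h | no q-b≰h = ⊥-elim (<-irrefl refl (<-≤-trans A<q-p q-p≤A))
  where
  A<q-p : A < q - p
  A<q-p = subst₂ _<_ (half+half A) (sub-add-sub p b q) (+-mono-< (≰⇒> b-p≰h) (≰⇒> q-b≰h))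

close-to-an-end : ∀ {A b p q} → Between b p q → abs (p - q) ≤ℚ A →
           abs (b - p) ≤ℚ A * ½ ⊎ abs (b - q) ≤ℚ A * ½
close-to-an-end {A} (inj₁ (p≤b , b≤q)) ∣p-q∣≤A =
  close-to-an-end-ordered p≤b b≤q (subst (_≤ℚ A) (p≤q⇒∣p-q∣≡q-p (≤-trans p≤b b≤q)) ∣p-q∣≤A)
close-to-an-end {A} (inj₂ (q≤b , b≤p)) ∣p-q∣≤A =
  swap (close-to-an-end-ordered q≤b b≤p (subst (_≤ℚ A) (p≤q⇒∣q-p∣≡q-p (≤-trans q≤b b≤p)) ∣p-q∣≤A))

ℕ→ℚ≤1 : ∀ {m} → m ≤ 1 → ℕ→ℚ m ≤ℚ 1ℚ
ℕ→ℚ≤1 z≤n       = ≤ᵇ⇒≤ _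
ℕ→ℚ≤1 (s≤s z≤n) = ≤-refl

module Walks {n : ℕ} (G : Graph n) where

  open import Data.List.Membership.DecPropositional (_≟_ {n}) using (_∈?_)

  private variable
    S T : Fin n → Set
    x y z u : Fin n
    m m′ : ℕ
    p : List (Fin n)

  adjacent-sym : adj G x y ≡ true → adj G y x ≡ true
  adjacent-sym {x} {y} x~y = ≡.trans (Graph.sym G y x) x~y

  adjacent⇒≢ : adj G x y ≡ true → x ≢ y
  adjacent⇒≢ {x} x~x refl with ≡.trans (≡.sym x~x) (irrefl G x)
  ... | ()

  walk-source : Walk G S x y m → S x
  walk-source (stay s)     = s
  walk-source (step s _ _) = s

  walk-target : Walk G S x y m → S y
  walk-target (stay s)     = s
  walk-target (step _ _ w) = walk-target w

  _++_ : Walk G S x y m → Walk G S y z m′ → Walk G S x z (m ℕ.+ m′)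
  stay _     ++ w′ = w′
  step s a w ++ w′ = step s a (w ++ w′)

  snoc : Walk G S x y m → adj G y z ≡ true → S z → Walk G S x z (suc m)
  snoc (stay s)     a s′ = step s a (stay s′)
  snoc (step s a w) a′ s′ = step s a (snoc w a′ s′)

  reverse : Walk G S x y m → Walk G S y x m
  reverse (stay s)     = stay s
  reverse (step s a w) = snoc (reverse w) (adjacent-sym a) s

  weaken : (∀ {v} → S v → T v) → Walk G S x y m → Walk G T x y m
  weaken S⊆T (stay s)     = stay (S⊆T s)
  weaken S⊆T (step s a w) = step (S⊆T s) a (weaken S⊆T w)

  pathLength : PathList G S x y p → ℕ
  pathLength (single _)   = 0
  pathLength (cons _ _ P) = suc (pathLength P)

  path-source : PathList G S x y p → S x
  path-source (single s)   = s
  path-source (cons s _ _) = s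

  source∈ : PathList G S x y p → x ∈ p
  source∈ (single _)   = here refl
  source∈ (cons _ _ _) = here refl

  target∈ : PathList G S x y p → y ∈ p
  target∈ (single _)   = here refl
  target∈ (cons _ _ P) = there (target∈ P)

  2≤length : PathList G S x y p → x ≢ y → 2 ≤ length p
  2≤length (single _)              x≢x = ⊥-elim (x≢x refl)
  2≤length (cons _ _ (single _))   _   = s≤s (s≤s z≤n)
  2≤length (cons _ _ (cons _ _ _)) _   = s≤s (s≤s z≤n)

  toWalk : (P : PathList G S x y p) → Walk G S x y (pathLength P)
  toWalk (single s)   = stay s
  toWalk (cons s a P) = step s a (toWalk P)

  restrict : (P : PathList G T x y p) → List.All S p → Walk G S x y (pathLength P)
  restrict (single _)   (s ∷ _)  = stay s
  restrict (cons _ a P) (s ∷ ss) = step s a (restrict P ss)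

  prefix : PathList G S x y p → u ∈ p → ∃[ q ] (PathList G S x u q × q ⊆ p)
  prefix (single s)   (here refl) = _ , single s , ⊆-refl
  prefix (cons s _ _) (here refl) = _ , single s , refl ∷ minimum _
  prefix (cons s a P) (there u∈p) with prefix P u∈p
  ... | q , Q , q⊆p = _ , cons s a Q , refl ∷ q⊆p

  suffix : (P : PathList G S y z p) → Unique p → x ∈ p →
           ∃[ q ] Σ[ Q ∈ PathList G S x z q ] (Unique q × pathLength Q ≤ pathLength P)
  suffix P@(single _)   !p (here refl) = _ , P , !p , ℕₚ.≤-refl
  suffix P@(cons _ _ _) !p (here refl) = _ , P , !p , ℕₚ.≤-refl
  suffix (cons _ _ P) (_ ∷ !p) (there x∈p) with suffix P !p x∈p
  ... | q , Q , !q , Q≤P = q , Q , !q , ℕₚ.m≤n⇒m≤1+n Q≤P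

  walk⇒path : Walk G S x z m → ∃[ p ] Σ[ P ∈ PathList G S x z p ] (Unique p × pathLength P ≤ m)
  walk⇒path (stay s) = _ , single s , [] ∷ [] , z≤n
  walk⇒path {x = x} (step s a w) with walk⇒path w
  ... | p , P , !p , P≤w with x ∈? p
  ...   | no x∉p  = x ∷ p , cons s a P , ¬Any⇒All¬ p x∉p ∷ !p , s≤s P≤w
  ...   | yes x∈p with suffix P !p x∈p
  ...     | q , Q , !q , Q≤P = q , Q , !q , ℕₚ.m≤n⇒m≤1+n (ℕₚ.≤-trans Q≤P P≤w)

  closed-path : PathList G S x x p → Unique p → p ≡ x ∷ []
  closed-path (single _)   _        = refl
  closed-path (cons _ _ P) (x∉ ∷ _) = ⊥-elim (List.lookup x∉ (target∈ P) refl)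

  forest-neighbour-on-path : IsForest G → adj G x y ≡ true → PathList G (All G) y z p →
                             Unique (x ∷ p) → adj G u x ≡ true → u ∈ p → u ≡ y
  forest-neighbour-on-path {x = x} {y = y} {u = u} forest x~y P !xp u~x u∈p with u ≟ y
  ... | yes u≡y = u≡y
  ... | no u≢y with prefix P u∈p
  ...   | q , Q , q⊆p = ⊥-elim (forest (x , u , x ∷ q , cycle-path , 3≤length , u~x))
    where
    cycle-path : IsPath G (All G) x u (x ∷ q)
    cycle-path = cons tt x~y Q , Unique-resp-⊇ (refl ∷ q⊆p) !xp
    3≤length : 3 ≤ length (x ∷ q)
    3≤length = s≤s (2≤length Q (λ y≡u → u≢y (≡.sym y≡u)))

  -- Each step x → v of the walk either follows P (v is its second vertex, else a
  -- cycle closes) or leaves it, and then v ∷ P is a path to continue from.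
  forest-path-inside : IsForest G → Walk G S x y m → (P : PathList G (All G) x y p) →
                       Unique p → List.All S p
  forest-path-inside _ (stay s) P !p with closed-path P !p
  ... | refl = s ∷ []
  forest-path-inside _ (step s _ _) (single _) _ = s ∷ []
  forest-path-inside {p = x ∷ p} forest (step {y = v} s x~v w) (cons _ x~y P) (x∉p ∷ !p)
    with v ∈? p
  ... | yes v∈p with forest-neighbour-on-path forest x~y P (x∉p ∷ !p) (adjacent-sym x~v) v∈p
  ...   | refl = s ∷ forest-path-inside forest w P !p
  forest-path-inside {p = x ∷ p} forest (step {y = v} s x~v w) (cons _ x~y P) (x∉p ∷ !p)
    | no v∉p = List.tail (forest-path-inside forest w (cons tt (adjacent-sym x~v) (cons tt x~y P))
                                              (v∉xp ∷ x∉p ∷ !p))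
    where
    v∉xp : List.All (v ≢_) (x ∷ p)
    v∉xp = (λ v≡x → adjacent⇒≢ x~v (≡.sym v≡x)) ∷ ¬Any⇒All¬ p v∉p

  forest-dist-inside : IsForest G → Walk G S x y m′ → Dist G (All G) x y m → Dist G S x y m
  forest-dist-inside {S = S} {x = x} {y = y} {m = m} forest w (shortest , minimal)
    with walk⇒path shortest
  ... | p , P , !p , P≤m =
    subst (Walk G S x y) P≡m inside , λ m″ w″ → minimal m″ (weaken (λ _ → tt) w″)
    where
    inside : Walk G S x y (pathLength P)
    inside = restrict P (forest-path-inside forest w P !p)
    P≡m : pathLength P ≡ m
    P≡m = ℕₚ.≤-antisym P≤m (minimal _ (weaken (λ _ → tt) inside))

module _ {n : ℕ} (G : Graph n) {S : Fin n → Set} (g : Fin n → ℚ) {A : ℚ} (0≤A : 0ℚ ≤ℚ A)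
         (edge-bound : ∀ {x y} → S x → S y → adj G x y ≡ true → abs (g x - g y) ≤ℚ A) where

  open Walks G

  discrete-ivt : ∀ {b x z p} → PathList G S x z p → Between b (g x) (g z) →
                 ∃[ u ] (u ∈ p × abs (b - g u) ≤ℚ A * ½)
  discrete-ivt {x = x} (single _) btw = x , here refl , reduce (close-to-an-end btw ∣gx-gx∣≤A)
    where
    ∣gx-gx∣≤A : abs (g x - g x) ≤ℚ A
    ∣gx-gx∣≤A = subst (λ d → abs d ≤ℚ A) (≡.sym (+-inverseʳ (g x))) 0≤A
  discrete-ivt (cons {x = x} {y = y} s x~y P) btw with between-split btw (g y)
  ... | inj₂ btw-yz with discrete-ivt P btw-yz
  ...   | u , u∈p , close = u , there u∈p , close
  discrete-ivt (cons {x = x} {y = y} s x~y P) btw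
      | inj₁ btw-yx with close-to-an-end btw-yx (edge-bound (path-source P) s (adjacent-sym x~y))
  ...   | inj₁ close-y = y , there (source∈ P) , close-y
  ...   | inj₂ close-x = x , here refl , close-x

module Embedding {n : ℕ} (F : Graph n) (forest : IsForest F) (K : Subset n) (f : Fin n → ℚ)
  {A B c : ℚ} (0≤A : 0ℚ ≤ℚ A) (0≤B : 0ℚ ≤ℚ B) (AB≤c : A * B ≤ℚ c)
  (bounds : ∀ x y → Outside F K x → Outside F K y → x ≢ y →
    ∃[ m ] (Dist F (All F) x y m × abs (f x - f y) ≤ℚ A * ℕ→ℚ m × ℕ→ℚ m ≤ℚ B * abs (f x - f y)))
  where

  open Walks F
  open ≤-Reasoning

  V∖K : Fin n → Set
  V∖K = Outside F K

  instance
    A-nonNeg : NonNegative A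
    A-nonNeg = nonNegative 0≤A
    B-nonNeg : NonNegative B
    B-nonNeg = nonNegative 0≤B

  edge-bound : ∀ {x y} → V∖K x → V∖K y → adj F x y ≡ true → abs (f x - f y) ≤ℚ A
  edge-bound {x} {y} x∉K y∉K x~y with bounds x y x∉K y∉K (adjacent⇒≢ x~y)
  ... | m , (_ , minimal) , stretch , _ = begin
    abs (f x - f y) ≤⟨ stretch ⟩
    A * ℕ→ℚ m       ≤⟨ *-monoˡ-≤-nonNeg A (ℕ→ℚ≤1 (minimal 1 (step tt x~y (stay tt)))) ⟩
    A * 1ℚ          ≡⟨ *-identityʳ A ⟩
    A               ∎

  B*∣d∣≤c*½ : ∀ {d} → abs d ≤ℚ A * ½ → B * abs d ≤ℚ c * ½
  B*∣d∣≤c*½ {d} ∣d∣≤A½ = begin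
    B * abs d     ≤⟨ *-monoˡ-≤-nonNeg B ∣d∣≤A½ ⟩
    B * (A * ½)   ≡⟨ *-½-swap A B ⟩
    (A * B) * ½   ≤⟨ *-monoʳ-≤-nonNeg ½ AB≤c ⟩
    c * ½         ∎

  0≤B*∣d∣ : ∀ d → 0ℚ ≤ℚ B * abs d
  0≤B*∣d∣ d = begin
    0ℚ         ≡⟨ ≡.sym (*-zeroʳ B) ⟩
    B * 0ℚ     ≤⟨ *-monoˡ-≤-nonNeg B (0≤∣p∣ d) ⟩
    B * abs d  ∎

  close⇒near : ∀ {x y m′} → Walk F V∖K x y m′ → abs (f x - f y) ≤ℚ A * ½ →
               ∃[ m ] (Dist F V∖K x y m × ℕ→ℚ m ≤ℚ c * ½)
  close⇒near {x} {y} w close with x ≟ y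
  ... | yes refl = 0 , (stay (walk-source w) , λ _ _ → z≤n) , ≤-trans (0≤B*∣d∣ _) (B*∣d∣≤c*½ close)
  ... | no x≢y with bounds x y (walk-source w) (walk-target w) x≢y
  ...   | m , dist , _ , contraction =
    m , forest-dist-inside forest w dist , ≤-trans contraction (B*∣d∣≤c*½ close)

  Far : ℚ → Fin n → List (Fin n) → Set
  Far R w P = ∀ u → u ∈ P → ∀ m → Dist F V∖K w u m → R ≤ℚ ℕ→ℚ m

  between⇒¬far : ∀ {v w z Pw P} → PathList F V∖K v w Pw → PathList F V∖K v z P →
                 Between (f w) (f v) (f z) → ¬ Far (c * ½ + 1ℚ) w P
  between⇒¬far Pw P btw far with discrete-ivt F f 0≤A edge-bound P btw
  ... | u , u∈P , close with prefix P u∈P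
  ...   | _ , Q , _ with close⇒near (reverse (toWalk Pw) ++ toWalk Q) close
  ...     | m , dist , m≤c½ = p+1≰p (c * ½) (≤-trans (far u u∈P m dist) m≤c½)

  median⇒¬far : ∀ {v w x y Pw Px Py} → PathList F V∖K v w Pw → PathList F V∖K v x Px →
                PathList F V∖K v y Py → Between (f w) (f x) (f y) →
                Far (c * ½ + 1ℚ) w Px → Far (c * ½ + 1ℚ) w Py → ⊥
  median⇒¬far {v} Pw Px Py btw far-x far-y with between-split btw (f v)
  ... | inj₁ btw-x = between⇒¬far Pw Px btw-x far-x
  ... | inj₂ btw-y = between⇒¬far Pw Py btw-y far-y

  no-tripod : ¬ Tripod F K (c * ½ + 1ℚ)
  no-tripod (v , v₁ , v₂ , v₃ , _ , _ , _ , (P₁ , _) , (P₂ , _) , (P₃ , _) ,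
             far₁₂ , far₁₃ , far₂₁ , far₂₃ , far₃₁ , far₃₂) with median (f v₁) (f v₂) (f v₃)
  ... | inj₁ btw        = median⇒¬far P₁ P₂ P₃ btw far₁₂ far₁₃
  ... | inj₂ (inj₁ btw) = median⇒¬far P₂ P₁ P₃ btw far₂₁ far₂₃
  ... | inj₂ (inj₂ btw) = median⇒¬far P₃ P₁ P₂ btw far₃₁ far₃₂

lemma7p1 : ∀ {n} (F : Graph n) (k : ℕ) (c : ℚ) → IsForest F → Embeds F k c →
    ∃[ X ] (∣ X ∣ ≤ k × ¬ Tripod F X (c * ½ + 1ℚ))
lemma7p1 F k c forest (K , ∣K∣≤k , f , _ , A , B , 0≤A , 0≤B , AB≤c , bounds) =
  K , ∣K∣≤k , Embedding.no-tripod F forest K f 0≤A 0≤B AB≤c bounds
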